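{- Let $\mu$ be a strict partition of length $\ell$ and let $n\ge\ell$. Let $\mathcal{N}_{\mu,n}$ be the filling of the (ordinary, French) diagram of $\mu$ in which every box of row $i$ contains $\{i\}$, except the rightmost box of row $i$, which contains $[i,n]=\{i,i+1,\dots,n\}$. Then $\mathcal{N}_{\mu,n}$ has maximum degree among all tableaux in $\mathrm{SVT}(\mu,n)$.
   Context: Partitions are drawn in French convention: row $i$ (from the bottom) has boxes $(i,1),\dots,(i,\mu_i)$; the box above $(i,j)$ is $(i+1,j)$, the box to its right is $(i,j+1)$. A strict partition has distinct nonzero parts. A set-valued tableau of shape $\mu$ assigns to each box $\mathsf B$ a nonempty finite set $T(\mathsf B)$ of positive integers with $\max T(\mathsf B)<\min T(\text{box above})$ and $\max T(\mathsf B)\le\min T(\text{box to the right})$ whenever these boxes exist; $\mathrm{SVT}(\mu,n)$: those with entries in $\{1,\dots,n\}$; $d(T)=\sum_{\mathsf B}|T(\mathsf B)|$. -}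

module Defs where

open import Data.Nat using (ℕ; zero; suc; _+_; _≤_; _<_; _≡ᵇ_; _≤ᵇ_)
open import Data.List using (List; []; _∷_; length; map)
open import Data.Nat.ListAction using (sum)
open import Data.List.Relation.Unary.All using (All)
open import Data.List.Relation.Unary.Linked using (Linked)
open import Data.Fin using (Fin; toℕ)
import Data.Fin as Fin
open import Data.Fin.Subset using (Subset; _∈_; Nonempty; ∣_∣)
open import Data.Vec using (tabulate)
open import Data.Bool using (if_then_else_)
open import Data.Product using (_×_)

-- A partition is a list of its parts μ₁, μ₂, …, μ_ℓ (row 1 = bottom row).
-- Strict partition: distinct nonzero parts, listed in decreasing order.
StrictPartition : List ℕ → Set
StrictPartition μ = Linked (λ a b → b < a) μ × All (λ a → 0 < a) μ

-- Length of row i (rows indexed from 1); 0 if i = 0 or i > ℓ.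
rowLen : List ℕ → ℕ → ℕ
rowLen []      _             = 0
rowLen (x ∷ μ) zero          = 0
rowLen (x ∷ μ) (suc zero)    = x
rowLen (x ∷ μ) (suc (suc i)) = rowLen μ (suc i)

-- (i , j) is a box of the diagram of μ (1-indexed, French convention).
IsBox : List ℕ → ℕ → ℕ → Set
IsBox μ i j = 1 ≤ i × 1 ≤ j × j ≤ rowLen μ i

-- A filling with entries in {1,…,n}: each box gets a subset of Fin n,
-- where k : Fin n stands for the integer toℕ k + 1.
Filling : ℕ → Set
Filling n = ℕ → ℕ → Subset n

-- Set-valued tableau of shape μ with entries in {1,…,n}.
-- max T(B) < min T(above) and max T(B) ≤ min T(right) are written out as
-- "every entry of B is < (resp. ≤) every entry of the neighbouring box",
-- which is equivalent for nonempty finite sets.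
IsSVT : (μ : List ℕ) (n : ℕ) → Filling n → Set
IsSVT μ n T =
  (∀ i j → IsBox μ i j → Nonempty (T i j)) ×
  (∀ i j → IsBox μ i j → IsBox μ (suc i) j →
     ∀ a b → a ∈ T i j → b ∈ T (suc i) j → toℕ a < toℕ b) ×
  (∀ i j → IsBox μ i j → IsBox μ i (suc j) →
     ∀ a b → a ∈ T i j → b ∈ T i (suc j) → toℕ a ≤ toℕ b)

range1 : ℕ → List ℕ
range1 zero    = []
range1 (suc m) = range1 m Data.List.++ (suc m ∷ [])

deg : (μ : List ℕ) {n : ℕ} → Filling n → ℕ
deg μ T = sum (map (λ i → sum (map (λ j → ∣ T i j ∣) (range1 (rowLen μ i))))
                   (range1 (length μ)))

Nfill : (μ : List ℕ) (n : ℕ) → Filling n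
Nfill μ n i j = tabulate λ k →
  if j ≡ᵇ rowLen μ i then i ≤ᵇ suc (toℕ k) else (suc (toℕ k) ≡ᵇ i)

-- In a set-valued tableau the entries of row i are at least i, because the
-- first column increases strictly. Along row i the boxes are weakly increasing
-- nonempty sets, so consecutive boxes share at most one entry; hence the r boxes
-- of the row hold at most (r − 1) + |[i,n]| = (r − 1) + (n − i + 1) entries in
-- total. The filling N_{μ,n} attains this bound in every row, and it is a
-- tableau since a strict partition has strictly decreasing rows, so every box
-- below another one is not the rightmost box of its row and contains {i}.
module Submission where

open import Defs
open import Data.Nat using (ℕ; _≤_)
open import Data.List using (List; length)
open import Data.Product using (_×_)

open import Data.Bool using (Bool; true; false; if_then_else_; T)
open import Data.Bool.Properties using (T-≡)
open import Data.Fin using (Fin; toℕ; fromℕ<)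
import Data.Fin as Fin
open import Data.Fin.Properties using (toℕ-fromℕ<)
open import Data.Fin.Subset
  using (Subset; _∈_; _⊆_; _∪_; ⊥; ⊤; Nonempty; ∣_∣; inside; outside)
open import Data.Fin.Subset.Properties
  using (∈⊤; ∉⊥; ∣⊤∣≡n; ∣⊥∣≡0; Empty-unique; x∈p∪q⁻; ∣q∣≤∣p∪q∣; p⊆q⇒∣p∣≤∣q∣;
         x∈p⇒∣p-x∣<∣p∣)
open import Data.List using ([]; _∷_; map; _++_)
open import Data.List.Properties using (map-++)
open import Data.List.Relation.Unary.All using (All; _∷_)
open import Data.List.Relation.Unary.Linked using (Linked; _∷_)
open import Data.Nat using (zero; suc; _+_; _∸_; _<_; pred; z≤n; s≤s; s≤s⁻¹; _≡ᵇ_)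
open import Data.Nat.ListAction using (sum)
open import Data.Nat.ListAction.Properties using (sum-++)
open import Data.Nat.Properties
open import Data.Product using (_,_; proj₁; proj₂)
open import Data.Sum using (inj₁; inj₂)
open import Data.Vec using (tabulate; _∷_; []; here; there)
open import Data.Vec.Properties using (lookup∘tabulate; []=⇒lookup; lookup⇒[]=)
open import Function.Bundles using (Equivalence)
open import Relation.Binary.PropositionalEquality
open import Relation.Nullary using (contradiction)

∈-tabulate⁺ : ∀ {n} (f : Fin n → Bool) {a : Fin n} → T (f a) → a ∈ tabulate f
∈-tabulate⁺ f {a} t =
  lookup⇒[]= a (tabulate f) (trans (lookup∘tabulate f a) (Equivalence.to T-≡ t))

∈-tabulate⁻ : ∀ {n} (f : Fin n → Bool) {a : Fin n} → a ∈ tabulate f → T (f a)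
∈-tabulate⁻ f {a} a∈ =
  Equivalence.from T-≡ (trans (sym (lookup∘tabulate f a)) ([]=⇒lookup a∈))

T-if : ∀ c {x y : Bool} → T x → T y → T (if c then x else y)
T-if true  tx _  = tx
T-if false _  ty = ty

T-if-true : ∀ {c x y : Bool} → T c → T x → T (if c then x else y)
T-if-true {true} _ tx = tx

atLeast : ∀ {n} → ℕ → Subset n
atLeast {zero}  _       = []
atLeast {suc n} zero    = ⊤
atLeast {suc n} (suc c) = outside ∷ atLeast c

∣atLeast∣ : ∀ n c → ∣ atLeast {n} c ∣ ≡ n ∸ c
∣atLeast∣ zero    c       = sym (0∸n≡0 c)
∣atLeast∣ (suc n) zero    = ∣⊤∣≡n (suc n)
∣atLeast∣ (suc n) (suc c) = ∣atLeast∣ n c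

∈-atLeast⁺ : ∀ {n c} {a : Fin n} → c ≤ toℕ a → a ∈ atLeast c
∈-atLeast⁺ {suc n} {zero}              _         = ∈⊤
∈-atLeast⁺ {suc n} {suc c} {Fin.suc a} (s≤s c≤a) = there (∈-atLeast⁺ c≤a)

∈-atLeast⁻ : ∀ {n c} {a : Fin n} → a ∈ atLeast c → c ≤ toℕ a
∈-atLeast⁻ {suc n} {zero}              _         = z≤n
∈-atLeast⁻ {suc n} {suc c} {Fin.suc a} (there a∈) = s≤s (∈-atLeast⁻ a∈)

Nonempty⇒0<∣p∣ : ∀ {n} {p : Subset n} → Nonempty p → 0 < ∣ p ∣
Nonempty⇒0<∣p∣ (_ , a∈p) = ≤-trans (s≤s z≤n) (x∈p⇒∣p-x∣<∣p∣ a∈p)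

_≤ₛ_ _<ₛ_ : ∀ {n} → Subset n → Subset n → Set
p ≤ₛ q = ∀ a b → a ∈ p → b ∈ q → toℕ a ≤ toℕ b
p <ₛ q = ∀ a b → a ∈ p → b ∈ q → toℕ a < toℕ b

≤ₛ-tail : ∀ {n} {x y} {p q : Subset n} → (x ∷ p) ≤ₛ (y ∷ q) → p ≤ₛ q
≤ₛ-tail p≤q a b a∈ b∈ = s≤s⁻¹ (p≤q (Fin.suc a) (Fin.suc b) (there a∈) (there b∈))

≤ₛ-zero⇒∣tail∣≡0 : ∀ {n} {x} {p q : Subset n} → (x ∷ p) ≤ₛ (inside ∷ q) → ∣ p ∣ ≡ 0
≤ₛ-zero⇒∣tail∣≡0 {n} p≤q = trans
  (cong ∣_∣ (Empty-unique λ (a , a∈p) → n≮0 (p≤q (Fin.suc a) Fin.zero (there a∈p) here)))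
  (∣⊥∣≡0 n)

-- Sets with p ≤ₛ q share at most one element.
∣p∣+∣q∣≤suc∣p∪q∣ : ∀ {n} (p q : Subset n) → p ≤ₛ q → ∣ p ∣ + ∣ q ∣ ≤ suc ∣ p ∪ q ∣
∣p∣+∣q∣≤suc∣p∪q∣ []            []            _   = z≤n
∣p∣+∣q∣≤suc∣p∪q∣ (outside ∷ p) (outside ∷ q) p≤q = ∣p∣+∣q∣≤suc∣p∪q∣ p q (≤ₛ-tail p≤q)
∣p∣+∣q∣≤suc∣p∪q∣ (inside ∷ p)  (outside ∷ q) p≤q = s≤s (∣p∣+∣q∣≤suc∣p∪q∣ p q (≤ₛ-tail p≤q))
∣p∣+∣q∣≤suc∣p∪q∣ (outside ∷ p) (inside ∷ q)  p≤q rewrite +-suc ∣ p ∣ ∣ q ∣ =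
  s≤s (∣p∣+∣q∣≤suc∣p∪q∣ p q (≤ₛ-tail p≤q))
∣p∣+∣q∣≤suc∣p∪q∣ (inside ∷ p)  (inside ∷ q)  p≤q rewrite ≤ₛ-zero⇒∣tail∣≡0 p≤q =
  s≤s (s≤s (∣q∣≤∣p∪q∣ p q))

∑ : ℕ → (ℕ → ℕ) → ℕ
∑ m f = sum (map f (range1 m))

syntax ∑ m (λ j → e) = ∑[ j ≤ m ] e

∑-suc : ∀ m (f : ℕ → ℕ) → ∑ (suc m) f ≡ ∑ m f + f (suc m)
∑-suc m f = begin
  sum (map f (range1 m ++ suc m ∷ []))        ≡⟨ cong sum (map-++ f (range1 m) (suc m ∷ [])) ⟩
  sum (map f (range1 m) ++ f (suc m) ∷ [])    ≡⟨ sum-++ (map f (range1 m)) (f (suc m) ∷ []) ⟩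
  ∑ m f + (f (suc m) + 0)                     ≡⟨ cong (∑ m f +_) (+-identityʳ (f (suc m))) ⟩
  ∑ m f + f (suc m)                           ∎
  where open ≡-Reasoning

∑-mono-≤ : ∀ m {f g : ℕ → ℕ} → (∀ j → j < m → f (suc j) ≤ g (suc j)) → ∑ m f ≤ ∑ m g
∑-mono-≤ zero    _   = z≤n
∑-mono-≤ (suc m) {f} {g} f≤g rewrite ∑-suc m f | ∑-suc m g =
  +-mono-≤ (∑-mono-≤ m λ j j<m → f≤g j (m≤n⇒m≤1+n j<m)) (f≤g m ≤-refl)

m≤∑ : ∀ m (f : ℕ → ℕ) → (∀ j → j < m → 0 < f (suc j)) → m ≤ ∑ m f
m≤∑ zero    _ _   = z≤n
m≤∑ (suc m) f f>0 rewrite ∑-suc m f = subst (_≤ ∑ m f + f (suc m)) (+-comm m 1)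
  (+-mono-≤ (m≤∑ m f λ j j<m → f>0 j (m≤n⇒m≤1+n j<m)) (f>0 m ≤-refl))

pred+last≤∑ : ∀ m (f : ℕ → ℕ) → 0 < m → (∀ j → suc j < m → 0 < f (suc j)) →
  pred m + f m ≤ ∑ m f
pred+last≤∑ (suc m) f _ f>0 rewrite ∑-suc m f =
  +-monoˡ-≤ (f (suc m)) (m≤∑ m f λ j j<m → f>0 j (s≤s j<m))

module IncreasingChain {n : ℕ} (S : ℕ → Subset n) (M c : ℕ)
  (nonempty   : ∀ j → j < M → Nonempty (S (suc j)))
  (increasing : ∀ j → suc j < M → S (suc j) ≤ₛ S (suc (suc j)))
  (bounded    : S 1 ⊆ atLeast c) where

  ⋃ : ℕ → Subset n
  ⋃ zero    = ⊥
  ⋃ (suc m) = ⋃ m ∪ S (suc m)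

  S⊆atLeast : ∀ j → j < M → S (suc j) ⊆ atLeast c
  S⊆atLeast zero    _     = bounded
  S⊆atLeast (suc j) sj<M {b} b∈ =
    ∈-atLeast⁺ (≤-trans (∈-atLeast⁻ (S⊆atLeast j j<M s∈)) (increasing j sj<M s b s∈ b∈))
    where
    j<M = <-trans (n<1+n j) sj<M
    s   = proj₁ (nonempty j j<M)
    s∈  = proj₂ (nonempty j j<M)

  ⋃⊆atLeast : ∀ m → m ≤ M → ⋃ m ⊆ atLeast c
  ⋃⊆atLeast zero    _   a∈ = contradiction a∈ ∉⊥
  ⋃⊆atLeast (suc m) m<M a∈ with x∈p∪q⁻ (⋃ m) (S (suc m)) a∈
  ... | inj₁ a∈⋃ = ⋃⊆atLeast m (<⇒≤ m<M) a∈⋃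
  ... | inj₂ a∈S = S⊆atLeast m m<M a∈S

  ⋃≤ₛS : ∀ m → m < M → ⋃ m ≤ₛ S (suc m)
  ⋃≤ₛS zero    _    _ _ a∈ _  = contradiction a∈ ∉⊥
  ⋃≤ₛS (suc m) sm<M a b a∈ b∈ with x∈p∪q⁻ (⋃ m) (S (suc m)) a∈
  ... | inj₂ a∈S = increasing m sm<M a b a∈S b∈
  ... | inj₁ a∈⋃ = ≤-trans (⋃≤ₛS m m<M a s a∈⋃ s∈) (increasing m sm<M s b s∈ b∈)
    where
    m<M = <-trans (n<1+n m) sm<M
    s   = proj₁ (nonempty m m<M)
    s∈  = proj₂ (nonempty m m<M)

  ∑∣S∣≤pred+∣⋃∣ : ∀ m → m ≤ M → ∑[ j ≤ m ] ∣ S j ∣ ≤ pred m + ∣ ⋃ m ∣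
  ∑∣S∣≤pred+∣⋃∣ zero          _     = z≤n
  ∑∣S∣≤pred+∣⋃∣ (suc zero)    _     =
    ≤-trans (≤-reflexive (+-identityʳ ∣ S 1 ∣)) (∣q∣≤∣p∪q∣ ⊥ (S 1))
  ∑∣S∣≤pred+∣⋃∣ (suc (suc m)) ssm≤M = begin
    ∑[ j ≤ suc (suc m) ] ∣ S j ∣                 ≡⟨ ∑-suc (suc m) (λ j → ∣ S j ∣) ⟩
    ∑[ j ≤ suc m ] ∣ S j ∣ + ∣ S (suc (suc m)) ∣ ≤⟨ +-monoˡ-≤ _ (∑∣S∣≤pred+∣⋃∣ (suc m) (<⇒≤ ssm≤M)) ⟩
    m + ∣ ⋃ (suc m) ∣ + ∣ S (suc (suc m)) ∣      ≡⟨ +-assoc m _ _ ⟩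
    m + (∣ ⋃ (suc m) ∣ + ∣ S (suc (suc m)) ∣)    ≤⟨ +-monoʳ-≤ m (∣p∣+∣q∣≤suc∣p∪q∣ _ _ (⋃≤ₛS (suc m) ssm≤M)) ⟩
    m + suc ∣ ⋃ (suc (suc m)) ∣                  ≡⟨ +-suc m _ ⟩
    suc m + ∣ ⋃ (suc (suc m)) ∣                  ∎
    where open ≤-Reasoning

  ∑∣S∣≤ : ∑[ j ≤ M ] ∣ S j ∣ ≤ pred M + (n ∸ c)
  ∑∣S∣≤ = begin
    ∑[ j ≤ M ] ∣ S j ∣         ≤⟨ ∑∣S∣≤pred+∣⋃∣ M ≤-refl ⟩
    pred M + ∣ ⋃ M ∣           ≤⟨ +-monoʳ-≤ (pred M) (p⊆q⇒∣p∣≤∣q∣ (⋃⊆atLeast M ≤-refl)) ⟩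
    pred M + ∣ atLeast {n} c ∣ ≡⟨ cong (pred M +_) (∣atLeast∣ n c) ⟩
    pred M + (n ∸ c)           ∎
    where open ≤-Reasoning

rowLen>0⇒≤length : ∀ μ i → 0 < rowLen μ i → i ≤ length μ
rowLen>0⇒≤length (_ ∷ μ) (suc zero)    _ = s≤s z≤n
rowLen>0⇒≤length (_ ∷ μ) (suc (suc i)) r>0 = s≤s (rowLen>0⇒≤length μ (suc i) r>0)

rowLen>0 : ∀ {μ} → All (0 <_) μ → ∀ i → i < length μ → 0 < rowLen μ (suc i)
rowLen>0 (x>0 ∷ _)   zero    _         = x>0
rowLen>0 (_ ∷ μ>0) (suc i) (s≤s i<ℓ) = rowLen>0 μ>0 i i<ℓ

rowLen-decreasing : ∀ {μ} → Linked (λ a b → b < a) μ →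
  ∀ i → 0 < rowLen μ (suc (suc i)) → rowLen μ (suc (suc i)) < rowLen μ (suc i)
rowLen-decreasing (y<x ∷ _)  zero    _   = y<x
rowLen-decreasing (_ ∷ desc) (suc i) r>0 = rowLen-decreasing desc i r>0

module _ {μ : List ℕ} {n : ℕ} (μ>0 : All (0 <_) μ) {T′ : Filling n} (svt : IsSVT μ n T′) where

  private
    nonempty = proj₁ svt
    columnStrict = proj₁ (proj₂ svt)
    rowWeak = proj₂ (proj₂ svt)

    firstBox : ∀ i → i < length μ → IsBox μ (suc i) 1
    firstBox i i<ℓ = s≤s z≤n , s≤s z≤n , rowLen>0 μ>0 i i<ℓ

  firstColumn⊆atLeast : ∀ i → i < length μ → T′ (suc i) 1 ⊆ atLeast i
  firstColumn⊆atLeast zero    _      _  = ∈-atLeast⁺ z≤n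
  firstColumn⊆atLeast (suc i) si<ℓ b∈ =
    ∈-atLeast⁺ (≤-trans (s≤s (∈-atLeast⁻ (firstColumn⊆atLeast i i<ℓ a∈)))
                        (columnStrict _ 1 (firstBox i i<ℓ) (firstBox (suc i) si<ℓ) a _ a∈ b∈))
    where
    i<ℓ = <-trans (n<1+n i) si<ℓ
    a   = proj₁ (nonempty _ 1 (firstBox i i<ℓ))
    a∈  = proj₂ (nonempty _ 1 (firstBox i i<ℓ))

  rowDegree≤ : ∀ i → i < length μ →
    ∑[ j ≤ rowLen μ (suc i) ] ∣ T′ (suc i) j ∣ ≤ pred (rowLen μ (suc i)) + (n ∸ i)
  rowDegree≤ i i<ℓ = IncreasingChain.∑∣S∣≤ (T′ (suc i)) (rowLen μ (suc i)) i
    (λ j j<r → nonempty _ _ (s≤s z≤n , s≤s z≤n , j<r))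
    (λ j sj<r → rowWeak _ _ (s≤s z≤n , s≤s z≤n , <⇒≤ sj<r) (s≤s z≤n , s≤s z≤n , sj<r))
    (firstColumn⊆atLeast i i<ℓ)

module _ (μ : List ℕ) (n : ℕ) where

  private
    N = Nfill μ n

  Nfill-entry : ∀ i j {a} → a ∈ N i j → i ≤ suc (toℕ a)
  Nfill-entry i j {a} a∈ with j ≡ᵇ rowLen μ i | ∈-tabulate⁻ _ a∈
  ... | true  | i≤a+1  = ≤ᵇ⇒≤ i (suc (toℕ a)) i≤a+1
  ... | false | a+1≡i = ≤-reflexive (sym (≡ᵇ⇒≡ (suc (toℕ a)) i a+1≡i))

  Nfill-inner-entry : ∀ i j {a} → j < rowLen μ i → a ∈ N i j → suc (toℕ a) ≡ i
  Nfill-inner-entry i j {a} j<r a∈ with j ≡ᵇ rowLen μ i in j≡r | ∈-tabulate⁻ _ a∈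
  ... | true  | _     = contradiction (≡ᵇ⇒≡ j _ (subst T (sym j≡r) _)) (<⇒≢ j<r)
  ... | false | a+1≡i = ≡ᵇ⇒≡ (suc (toℕ a)) i a+1≡i

  Nfill-∋ : ∀ i j {a} → suc (toℕ a) ≡ i → a ∈ N i j
  Nfill-∋ i j a+1≡i = ∈-tabulate⁺ _ (T-if (j ≡ᵇ rowLen μ i)
    (≤⇒≤ᵇ (≤-reflexive (sym a+1≡i))) (≡⇒≡ᵇ _ _ a+1≡i))

  atLeast⊆Nfill-last : ∀ i → atLeast i ⊆ N (suc i) (rowLen μ (suc i))
  atLeast⊆Nfill-last i a∈ = ∈-tabulate⁺ _
    (T-if-true (≡⇒≡ᵇ (rowLen μ (suc i)) _ refl) (≤⇒≤ᵇ (s≤s (∈-atLeast⁻ a∈))))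

  module _ (ℓ≤n : length μ ≤ n) where

    Nfill-nonempty : ∀ i j → IsBox μ i j → Nonempty (N i j)
    Nfill-nonempty (suc i) j (_ , j>0 , j≤r) =
      fromℕ< i<n , Nfill-∋ (suc i) j (cong suc (toℕ-fromℕ< i<n))
      where
      i<n = ≤-trans (rowLen>0⇒≤length μ (suc i) (≤-trans j>0 j≤r)) ℓ≤n

    rowDegree-Nfill : All (0 <_) μ → ∀ i → i < length μ →
      pred (rowLen μ (suc i)) + (n ∸ i) ≤ ∑[ j ≤ rowLen μ (suc i) ] ∣ N (suc i) j ∣
    rowDegree-Nfill μ>0 i i<ℓ = begin
      pred r + (n ∸ i)           ≡⟨ cong (pred r +_) (sym (∣atLeast∣ n i)) ⟩
      pred r + ∣ atLeast {n} i ∣ ≤⟨ +-monoʳ-≤ (pred r) (p⊆q⇒∣p∣≤∣q∣ (atLeast⊆Nfill-last i)) ⟩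
      pred r + ∣ N (suc i) r ∣   ≤⟨ pred+last≤∑ r (λ j → ∣ N (suc i) j ∣) r>0 inner>0 ⟩
      ∑[ j ≤ r ] ∣ N (suc i) j ∣ ∎
      where
      open ≤-Reasoning
      r = rowLen μ (suc i)
      r>0 = rowLen>0 μ>0 i i<ℓ
      inner>0 : ∀ j → suc j < r → 0 < ∣ N (suc i) (suc j) ∣
      inner>0 j sj<r =
        Nonempty⇒0<∣p∣ (Nfill-nonempty (suc i) (suc j) (s≤s z≤n , s≤s z≤n , <⇒≤ sj<r))

  Nfill-columnStrict : Linked (λ a b → b < a) μ →
    ∀ i j → IsBox μ i j → IsBox μ (suc i) j → N i j <ₛ N (suc i) j
  Nfill-columnStrict desc (suc i) j _ (_ , j>0 , j≤r′) a b a∈ b∈ =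
    subst (_< toℕ b) (suc-injective (sym (Nfill-inner-entry (suc i) j j<r a∈)))
      (s≤s⁻¹ (Nfill-entry _ j b∈))
    where
    j<r = ≤-<-trans j≤r′ (rowLen-decreasing desc i (≤-trans j>0 j≤r′))

  Nfill-rowWeak : ∀ i j → IsBox μ i (suc j) → N i j ≤ₛ N i (suc j)
  Nfill-rowWeak i j (_ , _ , j<r) a b a∈ b∈ =
    s≤s⁻¹ (≤-trans (≤-reflexive (Nfill-inner-entry i j j<r a∈)) (Nfill-entry i (suc j) b∈))

lemma5p4 : (μ : List ℕ) (n : ℕ) → StrictPartition μ → length μ ≤ n →
    IsSVT μ n (Nfill μ n) ×
    ((T : Filling n) → IsSVT μ n T → deg μ T ≤ deg μ (Nfill μ n))
lemma5p4 μ n (desc , μ>0) ℓ≤n = svt , maximal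
  where
  svt : IsSVT μ n (Nfill μ n)
  svt = Nfill-nonempty μ n ℓ≤n
      , Nfill-columnStrict μ n desc
      , (λ i j _ box′ → Nfill-rowWeak μ n i j box′)

  maximal : (T : Filling n) → IsSVT μ n T → deg μ T ≤ deg μ (Nfill μ n)
  maximal T svtT = ∑-mono-≤ (length μ) λ i i<ℓ →
    ≤-trans (rowDegree≤ μ>0 svtT i i<ℓ) (rowDegree-Nfill μ n ℓ≤n μ>0 i i<ℓ)
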